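{- Let $R\subseteq\Pi_3=\{123,\ 12/3,\ 13/2,\ 1/23,\ 1/2/3\}$ with $\#R\geq4$, and let $n\geq4$. Then $\#\Pi_n(R)=0$ if $\{1/2/3,\,123\}\subseteq R$, and $\#\Pi_n(R)=1$ otherwise.
   Context: $\Pi_n$ is the set of set partitions of $[n]=\{1,\dots,n\}$, written $B_1/B_2/\cdots/B_k$ with blocks in canonical order $\min B_1<\cdots<\min B_k$ and elements of each block listed increasingly; e.g. $13/2=\{\{1,3\},\{2\}\}$. For $\pi\in\Pi_m$ and $\sigma\in\Pi_n$, $\sigma$ contains the pattern $\pi$ if there is $S\subseteq[n]$ with $\#S=m$ such that the restriction $\{B\cap S: B\in\sigma,\ B\cap S\neq\emptyset\}$, relabeled by the order-preserving bijection $S\to[m]$, equals $\pi$; otherwise $\sigma$ avoids $\pi$. $\Pi_n(R)$ is the set of $\sigma\in\Pi_n$ avoiding every pattern in $R$. -}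

module Defs where

open import Data.Nat using (ℕ; zero; suc; _<_; _≤ᵇ_; _≡ᵇ_)
open import Data.Bool using (Bool; true; false; _∧_; if_then_else_; T)
open import Data.Fin using (Fin)
open import Data.Vec using (Vec; []; _∷_; lookup; toList)
open import Data.List using (List)
open import Data.Product using (Σ; _×_)
open import Function.Bundles using (_⇔_)
open import Relation.Binary.PropositionalEquality using (_≡_)
open import Relation.Nullary using (¬_)
open import Data.List.Membership.Propositional using (_∈_)
open import Data.List.Relation.Unary.Unique.Propositional using (Unique)
open import Data.List using (length)

-- A set partition of [n] is encoded by its (canonical) restricted growth
-- word: entry i is the index (0-based) of the block containing i+1, blocks
-- numbered in canonical order (by increasing minima).  A word is a valid
-- encoding iff every entry is at most the number of blocks seen so far.
rgsFrom : ℕ → List ℕ → Bool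
rgsFrom b List.[] = true
rgsFrom b (x List.∷ xs) = (x ≤ᵇ b) ∧ rgsFrom (if x ≡ᵇ b then suc b else b) xs

IsSetPartition : ∀ {n} → Vec ℕ n → Set
IsSetPartition v = T (rgsFrom 0 (toList v))

SameBlock : ∀ {n} → Vec ℕ n → Fin n → Fin n → Set
SameBlock v i j = lookup v i ≡ lookup v j

-- σ contains π: there is S ⊆ [n], #S = m, given by the strictly increasing
-- (order-preserving) map e : [m] → [n] onto S, such that the restriction of
-- σ to S, relabelled via e, equals π (i.e. has the same blocks).
Contains : ∀ {m n} → Vec ℕ n → Vec ℕ m → Set
Contains {m} {n} σ π =
  Σ (Fin m → Fin n) λ e →
    (∀ i j → Data.Fin._<_ i j → Data.Fin._<_ (e i) (e j)) ×
    (∀ i j → SameBlock σ (e i) (e j) ⇔ SameBlock π i j)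

Avoids : ∀ {m n} → Vec ℕ n → Vec ℕ m → Set
Avoids σ π = ¬ Contains σ π

data Π₃ : Set where
  p123 p12/3 p13/2 p1/23 p1/2/3 : Π₃

encode₃ : Π₃ → Vec ℕ 3
encode₃ p123   = 0 ∷ 0 ∷ 0 ∷ []
encode₃ p12/3  = 0 ∷ 0 ∷ 1 ∷ []
encode₃ p13/2  = 0 ∷ 1 ∷ 0 ∷ []
encode₃ p1/23  = 0 ∷ 1 ∷ 1 ∷ []
encode₃ p1/2/3 = 0 ∷ 1 ∷ 2 ∷ []

InΠav : ∀ {n} → List Π₃ → Vec ℕ n → Set
InΠav R σ = IsSetPartition σ × (∀ {p} → p ∈ R → Avoids σ (encode₃ p))

CardΠav : ℕ → List Π₃ → ℕ → Set
CardΠav n R k =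
  Σ (List (Vec ℕ n)) λ L →
    Unique L × (∀ σ → (σ ∈ L) ⇔ InΠav R σ) × (length L ≡ k)

-- A duplicate-free R holding at least four of the five patterns of Π₃ misses at most one
-- pattern.  A partition σ of [n], n ≥ 3, contains the pattern of each of its triples of
-- positions, so if σ avoids R then R misses some p and every triple of σ has pattern p.
-- Four positions exclude p ∈ {12/3, 13/2, 1/23}: for instance 12/3 on positions 0 1 2 says
-- σ₀ = σ₁ ≠ σ₂, while 12/3 on positions 0 2 3 says σ₀ = σ₂.  So Π_n(R) is empty when
-- 123, 1/2/3 ∈ R.  Otherwise p = 1/2/3 makes σ injective and p = 123 makes σ constant, and
-- the only restricted growth words of these kinds are 0 1 ⋯ n−1 and 0 0 ⋯ 0, which avoid R.

module Submission where

open import Defs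
open import Data.Nat using (ℕ; _≥_)
open import Data.List using (List; length)
open import Data.List.Membership.Propositional using (_∈_)
open import Data.List.Relation.Unary.Unique.Propositional using (Unique)
open import Data.Product using (_×_)
open import Relation.Nullary using (¬_)

open import Level using (Level)
open import Data.Bool using (T)
open import Data.Bool.Properties using (T-∧; T-≡)
open import Data.Empty using (⊥-elim)
open import Data.Fin as Fin using (Fin; toℕ; _<_)
open import Data.Fin.Properties using (<-cmp; <⇒≢; <-trans; toℕ-injective; suc-injective)
open import Data.List using ([]; _∷_; filter)
open import Data.List.Properties using (length-filter)
open import Data.List.Membership.Propositional using (_∉_)
open import Data.List.Membership.Propositional.Properties using (∈-filter⁺; ∈-filter⁻)
open import Data.List.Membership.Propositional.Properties.WithK using (unique∧set⇒bag)
open import Data.List.Relation.Unary.All using ([]; _∷_)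
open import Data.List.Relation.Unary.All.Properties using (¬Any⇒All¬)
open import Data.List.Relation.Unary.AllPairs using ([]; _∷_)
open import Data.List.Relation.Unary.Any using (here; there)
open import Data.List.Relation.Unary.Unique.Propositional.Properties using (filter⁺)
open import Data.List.Relation.Binary.BagAndSetEquality using (_∼[_]_; set; ∼bag⇒↭)
open import Data.List.Relation.Binary.Permutation.Propositional.Properties using (↭-length)
open import Data.List.Relation.Binary.Subset.Propositional using (_⊆_)
open import Data.Nat using (zero; suc; _+_; _≤_; z≤n; s≤s; z<s; s<s; _≟_)
open import Data.Nat.Properties
  using (≤-refl; ≤-antisym; ≤-pred; <⇒≱; ≤∧≢⇒<; n≤0⇒n≡0; ≤ᵇ⇒≤; ≤⇒≤ᵇ; ≡⇒≡ᵇ;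
         +-identityʳ; +-suc; +-cancelˡ-≡; module ≤-Reasoning)
open import Data.Product using (_,_; proj₁; proj₂)
open import Data.Sum using (_⊎_; inj₁; inj₂; [_,_])
open import Data.Vec using (Vec; []; _∷_; lookup; toList; replicate)
open import Data.Vec.Properties using (lookup-replicate; ≡-dec)
open import Function using (_∘_)
open import Function.Bundles using (_⇔_; mk⇔; Equivalence)
open import Function.Definitions using (Injective)
open import Relation.Binary.Definitions using (DecidableEquality; tri<; tri≈; tri>)
open import Relation.Binary.PropositionalEquality
  using (_≡_; _≢_; refl; sym; trans; cong; cong₂; subst; module ≡-Reasoning)
open import Relation.Nullary using (yes; no; contradiction)
open import Relation.Nullary.Decidable using (map′; toWitness)
open Equivalence using (to; from)

private
  variable
    n : ℕ
    p q : Π₃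
    R : List Π₃

module _ {a : Level} {A : Set a} (_≟ᴬ_ : DecidableEquality A) where

  open import Data.List.Membership.DecPropositional _≟ᴬ_ using (_∈?_)

  unique-⊆⇒length-≤ : {xs ys : List A} → Unique xs → Unique ys → xs ⊆ ys → length xs ≤ length ys
  unique-⊆⇒length-≤ {xs} {ys} xs! ys! xs⊆ys = begin
    length xs                   ≡⟨ ↭-length (∼bag⇒↭ (unique∧set⇒bag xs! ys∩xs! xs∼ys∩xs)) ⟩
    length (filter (_∈? xs) ys) ≤⟨ length-filter (_∈? xs) ys ⟩
    length ys                   ∎
    where
    open ≤-Reasoning
    ys∩xs! : Unique (filter (_∈? xs) ys)
    ys∩xs! = filter⁺ (_∈? xs) {ys} ys!
    xs∼ys∩xs : xs ∼[ set ] filter (_∈? xs) ys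
    xs∼ys∩xs = mk⇔ (λ x∈xs → ∈-filter⁺ (_∈? xs) (xs⊆ys x∈xs) x∈xs)
                   (proj₂ ∘ ∈-filter⁻ (_∈? xs) {xs = ys})

injective-if-<-separated : {m : ℕ} {A : Set} {f : Fin m → A} →
                           (∀ {i j} → i < j → f i ≢ f j) → Injective _≡_ _≡_ f
injective-if-<-separated separated {i} {j} fi≡fj with <-cmp i j
... | tri< i<j _ _ = contradiction fi≡fj (separated i<j)
... | tri≈ _ i≡j _ = i≡j
... | tri> _ _ j<i = contradiction (sym fi≡fj) (separated j<i)

SameKernel : {m : ℕ} → (Fin m → ℕ) → (Fin m → ℕ) → Set
SameKernel t u = ∀ a b → t a ≡ t b ⇔ u a ≡ u b

pattern 0F = Fin.zero
pattern 1F = Fin.suc 0F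
pattern 2F = Fin.suc 1F
pattern 3F = Fin.suc 2F

module _ {A B : Set} where

  ⇔-both : A → B → A ⇔ B
  ⇔-both a b = mk⇔ (λ _ → b) (λ _ → a)

  ⇔-neither : ¬ A → ¬ B → A ⇔ B
  ⇔-neither ¬a ¬b = mk⇔ (⊥-elim ∘ ¬a) (⊥-elim ∘ ¬b)

sameKernel₃ : {t u : Fin 3 → ℕ} →
              (t 0F ≡ t 1F ⇔ u 0F ≡ u 1F) → (t 0F ≡ t 2F ⇔ u 0F ≡ u 2F) →
              (t 1F ≡ t 2F ⇔ u 1F ≡ u 2F) → SameKernel t u
sameKernel₃ k₀₁ k₀₂ k₁₂ = kernel
  where
  flip⇔ : {x y x′ y′ : ℕ} → x ≡ y ⇔ x′ ≡ y′ → y ≡ x ⇔ y′ ≡ x′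
  flip⇔ k = mk⇔ (sym ∘ to k ∘ sym) (sym ∘ from k ∘ sym)
  kernel : SameKernel _ _
  kernel 0F 0F = ⇔-both refl refl
  kernel 0F 1F = k₀₁
  kernel 0F 2F = k₀₂
  kernel 1F 0F = flip⇔ k₀₁
  kernel 1F 1F = ⇔-both refl refl
  kernel 1F 2F = k₁₂
  kernel 2F 0F = flip⇔ k₀₂
  kernel 2F 1F = flip⇔ k₁₂
  kernel 2F 2F = ⇔-both refl refl

pattern₃ : (Fin 3 → ℕ) → Π₃
pattern₃ t with t 0F ≟ t 1F | t 0F ≟ t 2F | t 1F ≟ t 2F
... | yes _ | yes _ | _     = p123
... | yes _ | no _  | _     = p12/3
... | no _  | yes _ | _     = p13/2
... | no _  | no _  | yes _ = p1/23
... | no _  | no _  | no _  = p1/2/3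

pattern₃-kernel : (t : Fin 3 → ℕ) → SameKernel t (lookup (encode₃ (pattern₃ t)))
pattern₃-kernel t with t 0F ≟ t 1F | t 0F ≟ t 2F | t 1F ≟ t 2F
... | yes t₀₁ | yes t₀₂ | _ =
  sameKernel₃ (⇔-both t₀₁ refl) (⇔-both t₀₂ refl) (⇔-both (trans (sym t₀₁) t₀₂) refl)
... | yes t₀₁ | no t₀₂ | _ =
  sameKernel₃ (⇔-both t₀₁ refl) (⇔-neither t₀₂ λ ()) (⇔-neither (t₀₂ ∘ trans t₀₁) λ ())
... | no t₀₁ | yes t₀₂ | _ =
  sameKernel₃ (⇔-neither t₀₁ λ ()) (⇔-both t₀₂ refl) (⇔-neither (t₀₁ ∘ trans t₀₂ ∘ sym) λ ())
... | no t₀₁ | no t₀₂ | yes t₁₂ =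
  sameKernel₃ (⇔-neither t₀₁ λ ()) (⇔-neither t₀₂ λ ()) (⇔-both t₁₂ refl)
... | no t₀₁ | no t₀₂ | no t₁₂ =
  sameKernel₃ (⇔-neither t₀₁ λ ()) (⇔-neither t₀₂ λ ()) (⇔-neither t₁₂ λ ())

pattern₃-encode₃ : ∀ p → pattern₃ (lookup (encode₃ p)) ≡ p
pattern₃-encode₃ p123   = refl
pattern₃-encode₃ p12/3  = refl
pattern₃-encode₃ p13/2  = refl
pattern₃-encode₃ p1/23  = refl
pattern₃-encode₃ p1/2/3 = refl

encode₃-injective : Injective _≡_ _≡_ encode₃
encode₃-injective {p} {q} e = begin
  p                             ≡⟨ pattern₃-encode₃ p ⟨
  pattern₃ (lookup (encode₃ p)) ≡⟨ cong (pattern₃ ∘ lookup) e ⟩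
  pattern₃ (lookup (encode₃ q)) ≡⟨ pattern₃-encode₃ q ⟩
  q                             ∎
  where open ≡-Reasoning

_≟Π₃_ : DecidableEquality Π₃
p ≟Π₃ q = map′ encode₃-injective (cong encode₃) (≡-dec _≟_ (encode₃ p) (encode₃ q))

open import Data.List.Membership.DecPropositional _≟Π₃_ using (_∈?_)
open import Data.List.Relation.Unary.Unique.DecPropositional _≟Π₃_ using (unique?)

triple : Vec ℕ n → Fin n → Fin n → Fin n → Fin 3 → ℕ
triple σ i j k = lookup σ ∘ lookup (i ∷ j ∷ k ∷ [])

contains-triple : (σ : Vec ℕ n) {i j k : Fin n} → i < j → j < k →
                  Contains σ (encode₃ (pattern₃ (triple σ i j k)))
contains-triple σ {i} {j} {k} i<j j<k =
  lookup (i ∷ j ∷ k ∷ []) , increasing , pattern₃-kernel (triple σ i j k)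
  where
  increasing : ∀ a b → a < b → lookup (i ∷ j ∷ k ∷ []) a < lookup (i ∷ j ∷ k ∷ []) b
  increasing 0F 1F _ = i<j
  increasing 0F 2F _ = <-trans i<j j<k
  increasing 1F 2F _ = j<k
  increasing 0F 0F ()
  increasing 1F 0F ()
  increasing 1F 1F (s<s ())
  increasing 2F 0F ()
  increasing 2F 1F (s<s ())
  increasing 2F 2F (s<s (s<s ()))

AllTriples : Π₃ → Vec ℕ n → Set
AllTriples p σ = ∀ {i j k} → i < j → j < k → SameKernel (triple σ i j k) (lookup (encode₃ p))

allTriples-if-avoids-others : {σ : Vec ℕ n} → (∀ {q} → q ≢ p → Avoids σ (encode₃ q)) → AllTriples p σ
allTriples-if-avoids-others {p = p} {σ = σ} avoids {i} {j} {k} i<j j<k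
  with pattern₃ (triple σ i j k) ≟Π₃ p
... | yes refl = pattern₃-kernel (triple σ i j k)
... | no q≢p   = contradiction (contains-triple σ i<j j<k) (avoids q≢p)

allTriples-123⇒constant : {σ : Vec ℕ (3 + n)} → AllTriples p123 σ → ∀ i → lookup σ i ≡ lookup σ 0F
allTriples-123⇒constant h 0F                    = refl
allTriples-123⇒constant h 1F                    = sym (from (h {0F} {1F} {2F} z<s (s<s z<s) 0F 1F) refl)
allTriples-123⇒constant h (Fin.suc (Fin.suc i)) =
  sym (from (h {0F} {1F} {Fin.suc (Fin.suc i)} z<s (s<s z<s) 0F 2F) refl)

allTriples-1/2/3⇒injective : {σ : Vec ℕ (3 + n)} → AllTriples p1/2/3 σ → Injective _≡_ _≡_ (lookup σ)
allTriples-1/2/3⇒injective {σ = σ} h = injective-if-<-separated separated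
  where
  separated : ∀ {i j} → i < j → lookup σ i ≢ lookup σ j
  separated {0F} {1F} _ σ₀≡σ₁ = contradiction (to (h {0F} {1F} {2F} z<s (s<s z<s) 0F 1F) σ₀≡σ₁) λ ()
  separated {0F} {Fin.suc (Fin.suc j)} _ σ₀≡σⱼ =
    contradiction (to (h {0F} {1F} {Fin.suc (Fin.suc j)} z<s (s<s z<s) 0F 2F) σ₀≡σⱼ) λ ()
  separated {Fin.suc i} {j} i<j σᵢ≡σⱼ =
    contradiction (to (h {0F} {Fin.suc i} {j} z<s i<j 1F 2F) σᵢ≡σⱼ) λ ()

allTriples-of-four : {σ : Vec ℕ (4 + n)} → AllTriples p σ → p ≡ p123 ⊎ p ≡ p1/2/3
allTriples-of-four {p = p} {σ = σ} h =
  from-kernels p (h {0F} {1F} {2F} z<s (s<s z<s)) (h {0F} {2F} {3F} z<s (s<s (s<s z<s)))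
                 (h {1F} {2F} {3F} (s<s z<s) (s<s (s<s z<s)))
  where
  Kernel : Fin (4 + _) → Fin (4 + _) → Fin (4 + _) → Π₃ → Set
  Kernel i j k r = SameKernel (triple σ i j k) (lookup (encode₃ r))
  from-kernels : ∀ r → Kernel 0F 1F 2F r → Kernel 0F 2F 3F r → Kernel 1F 2F 3F r → r ≡ p123 ⊎ r ≡ p1/2/3
  from-kernels p123   _    _    _    = inj₁ refl
  from-kernels p1/2/3 _    _    _    = inj₂ refl
  from-kernels p12/3  k₀₁₂ k₀₂₃ _    = contradiction (to (k₀₁₂ 0F 2F) (from (k₀₂₃ 0F 1F) refl)) λ ()
  from-kernels p13/2  k₀₁₂ k₀₂₃ _    = contradiction (to (k₀₂₃ 0F 1F) (from (k₀₁₂ 0F 2F) refl)) λ ()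
  from-kernels p1/23  k₀₁₂ _    k₁₂₃ = contradiction (to (k₁₂₃ 0F 1F) (from (k₀₁₂ 1F 2F) refl)) λ ()

rgsFrom-head-≤ : ∀ {b x xs} → T (rgsFrom b (x ∷ xs)) → x ≤ b
rgsFrom-head-≤ {b} {x} rgs = ≤ᵇ⇒≤ x b (proj₁ (to T-∧ rgs))

rgsFrom-new-block : ∀ b xs → rgsFrom b (b ∷ xs) ≡ rgsFrom (suc b) xs
rgsFrom-new-block b xs rewrite to T-≡ (≤⇒≤ᵇ (≤-refl {b})) | to T-≡ (≡⇒≡ᵇ b b refl) = refl

-- countFrom 0 n encodes the partition 1/2/⋯/n, and replicate n 0 the one-block partition.
countFrom : ℕ → (n : ℕ) → Vec ℕ n
countFrom b zero    = []
countFrom b (suc n) = b ∷ countFrom (suc b) n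

lookup-countFrom : ∀ b (i : Fin n) → lookup (countFrom b n) i ≡ b + toℕ i
lookup-countFrom b 0F          = sym (+-identityʳ b)
lookup-countFrom b (Fin.suc i) = trans (lookup-countFrom (suc b) i) (sym (+-suc b (toℕ i)))

countFrom-injective : ∀ b → Injective _≡_ _≡_ (lookup (countFrom b n))
countFrom-injective b {i} {j} e =
  toℕ-injective (+-cancelˡ-≡ b _ _ (trans (sym (lookup-countFrom b i)) (trans e (lookup-countFrom b j))))

countFrom-rgsFrom : ∀ b n → T (rgsFrom b (toList (countFrom b n)))
countFrom-rgsFrom b zero    = _
countFrom-rgsFrom b (suc n) rewrite rgsFrom-new-block b (toList (countFrom (suc b) n)) =
  countFrom-rgsFrom (suc b) n

injective-rgsFrom⇒countFrom : ∀ b (σ : Vec ℕ n) → T (rgsFrom b (toList σ)) →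
                              Injective _≡_ _≡_ (lookup σ) → (∀ i → b ≤ lookup σ i) → σ ≡ countFrom b n
injective-rgsFrom⇒countFrom b []      _   _   _ = refl
injective-rgsFrom⇒countFrom b (x ∷ σ) rgs inj b≤
  with ≤-antisym (rgsFrom-head-≤ {xs = toList σ} rgs) (b≤ 0F)
... | refl = cong (b ∷_) (injective-rgsFrom⇒countFrom (suc b) σ rgs-tail (suc-injective ∘ inj) b<)
  where
  rgs-tail : T (rgsFrom (suc b) (toList σ))
  rgs-tail = subst T (rgsFrom-new-block b (toList σ)) rgs
  b< : ∀ i → suc b ≤ lookup σ i
  b< i = ≤∧≢⇒< (b≤ (Fin.suc i)) (λ b≡σᵢ → contradiction (inj {0F} {Fin.suc i} b≡σᵢ) λ ())

replicate-rgsFrom : ∀ n → T (rgsFrom 1 (toList (replicate n 0)))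
replicate-rgsFrom zero    = _
replicate-rgsFrom (suc n) = replicate-rgsFrom n

replicate-isSetPartition : ∀ n → IsSetPartition (replicate n 0)
replicate-isSetPartition zero    = _
replicate-isSetPartition (suc n) = replicate-rgsFrom n

isSetPartition-head : (σ : Vec ℕ (suc n)) → IsSetPartition σ → lookup σ 0F ≡ 0
isSetPartition-head (_ ∷ σ) rgs = n≤0⇒n≡0 (rgsFrom-head-≤ {xs = toList σ} rgs)

constant⇒replicate : {A : Set} {x : A} (σ : Vec A n) → (∀ i → lookup σ i ≡ x) → σ ≡ replicate n x
constant⇒replicate []      _        = refl
constant⇒replicate (y ∷ σ) constant = cong₂ _∷_ (constant 0F) (constant⇒replicate σ (constant ∘ Fin.suc))

contains⇒injective : {m : ℕ} {σ : Vec ℕ n} {π : Vec ℕ m} → Contains σ π →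
                     Injective _≡_ _≡_ (lookup σ) → Injective _≡_ _≡_ (lookup π)
contains⇒injective (e , increasing , kernel) σ-injective {a} {b} πa≡πb =
  injective-if-<-separated (λ a<b → <⇒≢ (increasing _ _ a<b)) (σ-injective (from (kernel a b) πa≡πb))

replicate-contains⇒single-block : {m x : ℕ} {π : Vec ℕ m} → Contains (replicate n x) π →
                                  ∀ a b → lookup π a ≡ lookup π b
replicate-contains⇒single-block {x = x} (e , _ , kernel) a b =
  to (kernel a b) (trans (lookup-replicate (e a) x) (sym (lookup-replicate (e b) x)))

single-block⇒123 : (∀ a b → lookup (encode₃ p) a ≡ lookup (encode₃ p) b) → p ≡ p123
single-block⇒123 {p123}   _    = refl
single-block⇒123 {p12/3}  same = contradiction (same 0F 2F) λ ()
single-block⇒123 {p13/2}  same = contradiction (same 0F 1F) λ ()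
single-block⇒123 {p1/23}  same = contradiction (same 0F 1F) λ ()
single-block⇒123 {p1/2/3} same = contradiction (same 0F 1F) λ ()

injective⇒1/2/3 : Injective _≡_ _≡_ (lookup (encode₃ p)) → p ≡ p1/2/3
injective⇒1/2/3 {p123}   injective = contradiction (injective {0F} {1F} refl) λ ()
injective⇒1/2/3 {p12/3}  injective = contradiction (injective {0F} {1F} refl) λ ()
injective⇒1/2/3 {p13/2}  injective = contradiction (injective {0F} {2F} refl) λ ()
injective⇒1/2/3 {p1/23}  injective = contradiction (injective {1F} {2F} refl) λ ()
injective⇒1/2/3 {p1/2/3} _         = refl

countFrom-avoids : p ≢ p1/2/3 → Avoids (countFrom 0 n) (encode₃ p)
countFrom-avoids {p} {n} p≢1/2/3 contains =
  p≢1/2/3 (injective⇒1/2/3 (contains⇒injective {σ = countFrom 0 n} {encode₃ p} contains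
                                                 (countFrom-injective 0)))

replicate-avoids : p ≢ p123 → Avoids (replicate n 0) (encode₃ p)
replicate-avoids {p} p≢123 contains =
  p≢123 (single-block⇒123 (replicate-contains⇒single-block {π = encode₃ p} contains))

∈∧∉⇒≢ : {A : Set} {x y : A} {xs : List A} → x ∈ xs → y ∉ xs → x ≢ y
∈∧∉⇒≢ x∈xs y∉xs refl = y∉xs x∈xs

all-Π₃ : List Π₃
all-Π₃ = p123 ∷ p12/3 ∷ p13/2 ∷ p1/23 ∷ p1/2/3 ∷ []

∈-all-Π₃ : ∀ p → p ∈ all-Π₃
∈-all-Π₃ p123   = here refl
∈-all-Π₃ p12/3  = there (here refl)
∈-all-Π₃ p13/2  = there (there (here refl))
∈-all-Π₃ p1/23  = there (there (there (here refl)))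
∈-all-Π₃ p1/2/3 = there (there (there (there (here refl))))

all-Π₃-unique : Unique all-Π₃
all-Π₃-unique = toWitness {a? = unique? all-Π₃} _

module _ {R : List Π₃} (R! : Unique R) (4≤∣R∣ : 4 ≤ length R) where

  others-∈ : p ∉ R → q ≢ p → q ∈ R
  others-∈ {p} {q} p∉R q≢p with q ∈? R
  ... | yes q∈R = q∈R
  ... | no  q∉R = contradiction (≤-pred (≤-pred ∣qpR∣≤5)) (<⇒≱ 4≤∣R∣)
    where
    ∣qpR∣≤5 : length (q ∷ p ∷ R) ≤ 5
    ∣qpR∣≤5 = unique-⊆⇒length-≤ _≟Π₃_ ((q≢p ∷ ¬Any⇒All¬ R q∉R) ∷ ¬Any⇒All¬ R p∉R ∷ R!)
                                  all-Π₃-unique (λ {x} _ → ∈-all-Π₃ x)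

  allTriples-of-avoider : p ∉ R → (σ : Vec ℕ n) → InΠav R σ → AllTriples p σ
  allTriples-of-avoider p∉R σ (_ , avoids) =
    allTriples-if-avoids-others {σ = σ} (λ q≢p → avoids (others-∈ p∉R q≢p))

  no-avoider : p123 ∈ R → p1/2/3 ∈ R → (σ : Vec ℕ (4 + n)) → ¬ InΠav R σ
  no-avoider 123∈R 1/2/3∈R σ σ∈Π =
    [ ∈∧∉⇒≢ 123∈R p∉R ∘ sym , ∈∧∉⇒≢ 1/2/3∈R p∉R ∘ sym ]
      (allTriples-of-four {σ = σ} (allTriples-of-avoider p∉R σ σ∈Π))
    where
    p∉R : pattern₃ (triple σ 0F 1F 2F) ∉ R
    p∉R p∈R = proj₂ σ∈Π p∈R (contains-triple σ z<s (s<s z<s))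

  avoiders-if-1/2/3∉R : p1/2/3 ∉ R → (σ : Vec ℕ (3 + n)) → InΠav R σ ⇔ σ ≡ countFrom 0 (3 + n)
  avoiders-if-1/2/3∉R {n} 1/2/3∉R σ = mk⇔
    (λ σ∈Π → injective-rgsFrom⇒countFrom 0 σ (proj₁ σ∈Π)
               (allTriples-1/2/3⇒injective {σ = σ} (allTriples-of-avoider 1/2/3∉R σ σ∈Π)) (λ _ → z≤n))
    (λ { refl → countFrom-rgsFrom 0 (3 + n) , λ q∈R → countFrom-avoids (∈∧∉⇒≢ q∈R 1/2/3∉R) })

  avoiders-if-123∉R : p123 ∉ R → (σ : Vec ℕ (3 + n)) → InΠav R σ ⇔ σ ≡ replicate (3 + n) 0
  avoiders-if-123∉R {n} 123∉R σ = mk⇔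
    (λ σ∈Π → constant⇒replicate σ λ i →
               trans (allTriples-123⇒constant {σ = σ} (allTriples-of-avoider 123∉R σ σ∈Π) i)
                     (isSetPartition-head σ (proj₁ σ∈Π)))
    (λ { refl → replicate-isSetPartition (3 + n) , λ q∈R → replicate-avoids (∈∧∉⇒≢ q∈R 123∉R) })

CardΠav-empty : (∀ (σ : Vec ℕ n) → ¬ InΠav R σ) → CardΠav n R 0
CardΠav-empty none = [] , [] , (λ σ → mk⇔ (λ ()) (⊥-elim ∘ none σ)) , refl

CardΠav-singleton : (τ : Vec ℕ n) → (∀ σ → InΠav R σ ⇔ σ ≡ τ) → CardΠav n R 1
CardΠav-singleton τ only-τ = τ ∷ [] , [] ∷ [] , (λ σ → mk⇔ (from (only-τ σ) ∘ ∈-[τ]) (here ∘ to (only-τ σ))) , refl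
  where
  ∈-[τ] : ∀ {σ} → σ ∈ τ ∷ [] → σ ≡ τ
  ∈-[τ] (here σ≡τ) = σ≡τ

proposition3p2 : (R : List Π₃) → Unique R → length R ≥ 4 → (n : ℕ) → n ≥ 4 →
    ((p1/2/3 ∈ R × p123 ∈ R) → CardΠav n R 0)
    × (¬ (p1/2/3 ∈ R × p123 ∈ R) → CardΠav n R 1)
proposition3p2 R R! 4≤∣R∣ (suc (suc (suc (suc n)))) (s≤s (s≤s (s≤s (s≤s _)))) = none , one
  where
  none : p1/2/3 ∈ R × p123 ∈ R → CardΠav (4 + n) R 0
  none (1/2/3∈R , 123∈R) = CardΠav-empty (no-avoider R! 4≤∣R∣ 123∈R 1/2/3∈R)
  one : ¬ (p1/2/3 ∈ R × p123 ∈ R) → CardΠav (4 + n) R 1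
  one ¬both with p1/2/3 ∈? R
  ... | yes 1/2/3∈R = CardΠav-singleton (replicate _ 0) (avoiders-if-123∉R R! 4≤∣R∣ (¬both ∘ (1/2/3∈R ,_)))
  ... | no  1/2/3∉R = CardΠav-singleton (countFrom 0 _) (avoiders-if-1/2/3∉R R! 4≤∣R∣ 1/2/3∉R)
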